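{- Let $N\ge1$ be an integer and $\chi$ a Dirichlet character of conductor $f$. For $m\ge 1$ put $\alpha_m=\frac{N!\,f^m}{(N+m)!}$, $\alpha_0=1$, and $\alpha_m=0$ for $m<0$; put \[ \widehat S_m=\frac{1}{f^N}\sum_{a=1}^f\chi(a)\left(\frac{N!}{(N+m)!}f^m-\frac{a^m}{m!}\right),\qquad \widehat S_m(x)=\frac{1}{f^N}\sum_{a=1}^f\chi(a)\left(\frac{N!}{(N+m)!}f^m-\frac{(x+a)^m}{m!}\right). \] For $n\ge1$ let $M_n$ be the $n\times n$ matrix whose entries are $(M_n)_{i,j}=\alpha_{i-j+1}$ for $1\le i\le n-1$, $1\le j\le n$, and $(M_n)_{n,j}=\widehat S_{n-j+1}$ for $1\le j\le n$; i.e. \[ M_n=\begin{pmatrix} \alpha_1&1&0&\cdots&0\\ \alpha_2&\alpha_1&1&\ddots&\vdots\\ \vdots&&\ddots&\ddots&0\\ \alpha_{n-1}&\cdots&\alpha_2&\alpha_1&1\\ \widehat S_n&\widehat S_{n-1}&\cdots&\widehat S_2&\widehat S_1 \end{pmatrix}, \] and let $M_n(x)$ be the same matrix with last row $\widehat S_n(x),\widehat S_{n-1}(x),\dots,\widehat S_1(x)$. Then for $n\ge1$, \[ B_{N,n,\chi}=(-1)^n n!\,\det M_n,\qquad B_{N,n,\chi}(x)=(-1)^n n!\,\det M_n(x). \]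
   Context: For an integer $N\ge 1$ and a Dirichlet character $\chi$ of conductor $f$, the generalized hypergeometric Bernoulli numbers $B_{N,n,\chi}$ and polynomials $B_{N,n,\chi}(x)$ are defined by $\sum_{a=1}^f \frac{\chi(a)\, t^N e^{at}/N!}{e^{ft}-\sum_{m=0}^{N-1}\frac{(ft)^m}{m!}}=\sum_{n=0}^\infty B_{N,n,\chi}\frac{t^n}{n!}$ and $\sum_{a=1}^f \frac{\chi(a)\, t^N e^{(x+a)t}/N!}{e^{ft}-\sum_{m=0}^{N-1}\frac{(ft)^m}{m!}}=\sum_{n=0}^\infty B_{N,n,\chi}(x)\frac{t^n}{n!}$ for $|t|<2\pi/f$. -}

module Defs where

open import Level using (Level)
open import Data.Nat as ℕ using (ℕ; zero; suc; _∸_; _<_; _!)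
open import Data.Nat.Divisibility using (_∣_)
open import Data.Nat.GCD using (gcd)
open import Data.Integer as ℤ using (ℤ; +_; -[1+_])
open import Data.Rational as ℚ using (ℚ)
open import Data.Rational.Properties using (+-*-rawRing)
open import Data.Fin as Fin using (Fin; toℕ; punchIn)
open import Data.Product using (Σ; _×_; ∃)
open import Relation.Nullary using (¬_; does)
open import Relation.Binary.PropositionalEquality using (_≡_; _≢_)
open import Data.Bool using (if_then_else_)
open import Algebra.Bundles using (CommutativeRing)
open import Algebra.Morphism.Structures using (IsRingHomomorphism)

-- The rational number p / q; the denominator q is always positive where used
-- (factorials, and f^N with f ≥ 1); q = 0 gives a junk value 0 never used.
frac : ℤ → ℕ → ℚ
frac p zero    = ℚ.0ℚ
frac p (suc q) = p ℚ./ suc q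

module _ {c ℓ : Level} (K : CommutativeRing c ℓ) where
  open CommutativeRing K

  IsQAlgebra : (ℚ → Carrier) → Set ℓ
  IsQAlgebra ι = IsRingHomomorphism +-*-rawRing rawRing ι

  record IsDirichletCharacter (f : ℕ) (χ : ℕ → Carrier) : Set (c Level.⊔ ℓ) where
    field
      periodic        : ∀ a → χ (a ℕ.+ f) ≈ χ a
      multiplicative  : ∀ a b → χ (a ℕ.* b) ≈ χ a * χ b
      one             : χ 1 ≈ 1#
      vanish          : ∀ a → gcd a f ≢ 1 → χ a ≈ 0#
      nonvanish       : ∀ a → gcd a f ≡ 1 → ¬ (χ a ≈ 0#)

  -- χ has conductor f : f ≥ 1, χ is a Dirichlet character mod f, and χ is
  -- primitive: it is not induced by a character modulo a proper divisor d of f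
  -- (i.e. for every d ∣ f with d < f there is a ≡ 1 (mod d), coprime to f,
  -- with χ(a) ≠ 1).
  record HasConductor (f : ℕ) (χ : ℕ → Carrier) : Set (c Level.⊔ ℓ) where
    field
      f≥1       : 1 ℕ.≤ f
      character : IsDirichletCharacter f χ
      isPrimitive : ∀ d → d ∣ f → d < f →
                  ∃ λ a → 1 ℕ.≤ a × d ∣ (a ∸ 1) × gcd a f ≡ 1 × ¬ (χ a ≈ 1#)

  pow : Carrier → ℕ → Carrier
  pow y zero    = 1#
  pow y (suc k) = y * pow y k

  sign : ℕ → Carrier
  sign zero    = 1#
  sign (suc k) = - sign k

  sum1 : ℕ → (ℕ → Carrier) → Carrier
  sum1 zero    g = 0#
  sum1 (suc f) g = sum1 f g + g (suc f)

  sum0 : ℕ → (ℕ → Carrier) → Carrier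
  sum0 zero    g = g 0
  sum0 (suc k) g = sum0 k g + g (suc k)

  sumFin : ∀ n → (Fin n → Carrier) → Carrier
  sumFin zero    g = 0#
  sumFin (suc n) g = g Fin.zero + sumFin n (λ j → g (Fin.suc j))

  det : ∀ n → (Fin n → Fin n → Carrier) → Carrier
  det zero    M = 1#
  det (suc n) M = sumFin (suc n) λ j →
    sign (toℕ j) * (M Fin.zero j * det n (λ r s → M (Fin.suc r) (punchIn j s)))

  module _ (ι : ℚ → Carrier) (N f : ℕ) (χ : ℕ → Carrier) where

    nat : ℕ → Carrier
    nat a = ι (frac (+ a) 1)

    alpha : ℤ → Carrier
    alpha -[1+ m ]     = 0#
    alpha (+ zero)     = 1#
    alpha (+ (suc m))  = ι (frac (+ (N ! ℕ.* (f ℕ.^ suc m))) ((N ℕ.+ suc m) !))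

    Shat : ℕ → Carrier
    Shat m = ι (frac (+ 1) (f ℕ.^ N)) * sum1 f (λ a →
      χ a * (ι (frac (+ (N ! ℕ.* (f ℕ.^ m))) ((N ℕ.+ m) !))
             - pow (nat a) m * ι (frac (+ 1) (m !))))

    Shatx : Carrier → ℕ → Carrier
    Shatx x m = ι (frac (+ 1) (f ℕ.^ N)) * sum1 f (λ a →
      χ a * (ι (frac (+ (N ! ℕ.* (f ℕ.^ m))) ((N ℕ.+ m) !))
             - pow (x + nat a) m * ι (frac (+ 1) (m !))))

    -- the n × n matrix with rows 1..n-1 given by α_{i-j+1} and last row
    -- given by (lastRow (n-j+1))_{j}; indices are 0-based here:
    -- entry (i',j') = α_{i'-j'+1} for i' < n-1, = lastRow (n - j') for i' = n-1.
    hessMatrix : (ℕ → Carrier) → ∀ n → Fin n → Fin n → Carrier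
    hessMatrix lastRow n i j =
      if does (suc (toℕ i) ℕ.≟ n)
        then lastRow (n ∸ toℕ j)
        else alpha ((+ suc (toℕ i)) ℤ.- (+ toℕ j))

    Mmat : ∀ n → Fin n → Fin n → Carrier
    Mmat = hessMatrix Shat

    Mmatx : Carrier → ∀ n → Fin n → Fin n → Carrier
    Mmatx x = hessMatrix (Shatx x)

    -- Coefficient of t^k in  e^{ft} - Σ_{m=0}^{N-1} (ft)^m/m!  :
    -- f^k / k! if k ≥ N, and 0 otherwise.
    denomCoeff : ℕ → Carrier
    denomCoeff k = if does (N ℕ.≤? k) then ι (frac (+ (f ℕ.^ k)) (k !)) else 0#

    -- Coefficient of t^k in  Σ_{a=1}^f χ(a) t^N e^{at} / N!
    numCoeff : ℕ → Carrier
    numCoeff k = if does (N ℕ.≤? k)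
      then sum1 f (λ a → χ a * (pow (nat a) (k ∸ N)
                                 * ι (frac (+ 1) (((k ∸ N) !) ℕ.* (N !)))))
      else 0#

    -- Coefficient of t^k in  Σ_{a=1}^f χ(a) t^N e^{(x+a)t} / N!
    numCoeffx : Carrier → ℕ → Carrier
    numCoeffx x k = if does (N ℕ.≤? k)
      then sum1 f (λ a → χ a * (pow (x + nat a) (k ∸ N)
                                 * ι (frac (+ 1) (((k ∸ N) !) ℕ.* (N !)))))
      else 0#

    -- B is the coefficient sequence of the generating function, i.e.
    --   numerator(t) = denominator(t) · Σ_n B_n t^n / n!   as formal power series
    -- (coefficient of t^k on both sides).
    IsGenSeq : (ℕ → Carrier) → (ℕ → Carrier) → Set ℓ
    IsGenSeq num B = ∀ k →
      sum0 k (λ i → (B i * ι (frac (+ 1) (i !))) * denomCoeff (k ∸ i)) ≈ num k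

    IsHypBernoulli : (ℕ → Carrier) → Set ℓ
    IsHypBernoulli = IsGenSeq numCoeff

    IsHypBernoulliPoly : Carrier → (ℕ → Carrier) → Set ℓ
    IsHypBernoulliPoly x = IsGenSeq (numCoeffx x)

module Submission where

open import Level using (Level)
open import Data.Bool using (if_then_else_)
open import Data.Bool.Properties using (if-cong)
open import Data.Nat as ℕ using (ℕ; zero; suc; _∸_; _≤_; _<_; z≤n; s≤s; _!)
import Data.Nat.Properties as ℕP
open import Data.Nat.Induction using (<-rec)
open import Data.Integer as ℤ using (ℤ; +_; -[1+_])
import Data.Integer.Properties as ℤP
open import Data.Rational as ℚ using (ℚ)
import Data.Rational.Properties as ℚP
open ℚP using (+-*-rawRing)
open import Data.Rational.Unnormalised as ℚᵘ using (mkℚᵘ; *≡*)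
import Data.Rational.Unnormalised.Properties as ℚᵘP
open import Data.Fin as Fin using (Fin; toℕ; punchIn)
open import Data.Product using (_×_; _,_)
open import Data.Maybe using (Maybe; just; nothing)
open import Relation.Nullary using (does; yes; no)
open import Relation.Nullary.Decidable using (dec-true; dec-false)
open import Relation.Binary.PropositionalEquality as ≡ using (_≡_)
open import Algebra.Bundles using (CommutativeRing)
open import Algebra.Morphism.Structures using (IsRingHomomorphism)
open import Defs

-- Writing b_n = B_{N,n,χ} / n!, the denominator of the generating function is
-- (f^N/N!) t^N Σ_j α_j t^j, so comparing coefficients of t^{N+n} gives
-- Σ_{i=0}^{n} α_{n-i} b_i = f^{-N} Σ_a χ(a) a^n / n!. Subtracting α_n times the case n = 0 leaves
-- the unit lower triangular Toeplitz system Σ_{i=1}^{n} α_{n-i} b_i = -Ŝ_n (n ≥ 1). Expanding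
-- det M_n along its first row, whose only nonzero entries are the first one and α_0 = 1, shows
-- that (-1)^n det M_n solves the same system, hence equals b_n. For B_{N,n,χ}(x) replace a by x + a.

+[1+m]-+[1+n]≡+m-+n : ∀ m n → + suc m ℤ.- + suc n ≡ + m ℤ.- + n
+[1+m]-+[1+n]≡+m-+n m n = begin
  + suc m ℤ.- + suc n ≡⟨ ℤP.m-n≡m⊖n (suc m) (suc n) ⟩
  suc m ℤ.⊖ suc n     ≡⟨ ℤP.[1+m]⊖[1+n]≡m⊖n m n ⟩
  m ℤ.⊖ n             ≡⟨ ℤP.m-n≡m⊖n m n ⟨
  + m ℤ.- + n         ∎
  where open ≡.≡-Reasoning

module _ {c ℓ : Level} (K : CommutativeRing c ℓ) where
  open CommutativeRing K
  open import Algebra.Properties.Ring ring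
    using (-‿distribˡ-*; -‿distribʳ-*; -‿involutive; -‿+-comm; +-cancelˡ; -0#≈0#; -1*x≈-x)
  open import Algebra.Properties.CommutativeSemigroup +-commutativeSemigroup
    using () renaming (interchange to +-interchange)
  open import Algebra.Properties.CommutativeSemigroup *-commutativeSemigroup using (x∙yz≈y∙xz)
  open import Relation.Binary.Reasoning.Setoid setoid

  sum0-cong : ∀ n {g h : ℕ → Carrier} → (∀ i → i ≤ n → g i ≈ h i) →
              sum0 K n g ≈ sum0 K n h
  sum0-cong zero    g≈h = g≈h 0 z≤n
  sum0-cong (suc n) g≈h =
    +-cong (sum0-cong n λ i i≤n → g≈h i (ℕP.m≤n⇒m≤1+n i≤n)) (g≈h (suc n) ℕP.≤-refl)

  sum1-cong : ∀ n {g h : ℕ → Carrier} → (∀ i → 1 ≤ i → i ≤ n → g i ≈ h i) →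
              sum1 K n g ≈ sum1 K n h
  sum1-cong zero    g≈h = refl
  sum1-cong (suc n) g≈h =
    +-cong (sum1-cong n λ i 1≤i i≤n → g≈h i 1≤i (ℕP.m≤n⇒m≤1+n i≤n))
           (g≈h (suc n) (s≤s z≤n) ℕP.≤-refl)

  sum0≈head+sum1 : ∀ n (g : ℕ → Carrier) → sum0 K n g ≈ g 0 + sum1 K n g
  sum0≈head+sum1 zero    g = sym (+-identityʳ _)
  sum0≈head+sum1 (suc n) g = trans (+-congʳ (sum0≈head+sum1 n g)) (+-assoc _ _ _)

  sum0-*ˡ : ∀ n x (g : ℕ → Carrier) → sum0 K n (λ i → x * g i) ≈ x * sum0 K n g
  sum0-*ˡ zero    x g = refl
  sum0-*ˡ (suc n) x g = trans (+-congʳ (sum0-*ˡ n x g)) (sym (distribˡ _ _ _))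

  sum1-*ʳ : ∀ n x (g : ℕ → Carrier) → sum1 K n (λ i → g i * x) ≈ sum1 K n g * x
  sum1-*ʳ zero    x g = sym (zeroˡ x)
  sum1-*ʳ (suc n) x g = trans (+-congʳ (sum1-*ʳ n x g)) (sym (distribʳ _ _ _))

  sum1-+ : ∀ n (g h : ℕ → Carrier) → sum1 K n (λ i → g i + h i) ≈ sum1 K n g + sum1 K n h
  sum1-+ zero    g h = sym (+-identityʳ 0#)
  sum1-+ (suc n) g h = trans (+-congʳ (sum1-+ n g h)) (+-interchange _ _ _ _)

  sum1-neg : ∀ n (g : ℕ → Carrier) → sum1 K n (λ i → - g i) ≈ - sum1 K n g
  sum1-neg zero    g = sym -0#≈0#
  sum1-neg (suc n) g = trans (+-congʳ (sum1-neg n g)) (-‿+-comm _ _)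

  sum0-vanishing-tail : ∀ m t (g : ℕ → Carrier) →
                        (∀ i → m < i → i ≤ t ℕ.+ m → g i ≈ 0#) →
                        sum0 K (t ℕ.+ m) g ≈ sum0 K m g
  sum0-vanishing-tail m zero    g g≈0 = refl
  sum0-vanishing-tail m (suc t) g g≈0 = trans
    (+-cong (sum0-vanishing-tail m t g λ i m<i i≤t+m → g≈0 i m<i (ℕP.m≤n⇒m≤1+n i≤t+m))
            (g≈0 (suc (t ℕ.+ m)) (s≤s (ℕP.m≤n+m m t)) ℕP.≤-refl))
    (+-identityʳ _)

  sumFin-cong : ∀ n {g h : Fin n → Carrier} → (∀ j → g j ≈ h j) → sumFin K n g ≈ sumFin K n h
  sumFin-cong zero    g≈h = refl
  sumFin-cong (suc n) g≈h = +-cong (g≈h Fin.zero) (sumFin-cong n λ j → g≈h (Fin.suc j))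

  sumFin-zero : ∀ n {g : Fin n → Carrier} → (∀ j → g j ≈ 0#) → sumFin K n g ≈ 0#
  sumFin-zero zero    g≈0 = refl
  sumFin-zero (suc n) g≈0 =
    trans (+-cong (g≈0 Fin.zero) (sumFin-zero n λ j → g≈0 (Fin.suc j))) (+-identityʳ 0#)

  det-cong : ∀ n {M M′ : Fin n → Fin n → Carrier} → (∀ i j → M i j ≈ M′ i j) →
             det K n M ≈ det K n M′
  det-cong zero    M≈M′ = refl
  det-cong (suc n) M≈M′ = sumFin-cong (suc n) λ j →
    *-congˡ {sign K (toℕ j)}
      (*-cong (M≈M′ Fin.zero j) (det-cong n λ r s → M≈M′ (Fin.suc r) (punchIn j s)))

  *-cancelˡ-invertible : ∀ {u v x y} → v * u ≈ 1# → u * x ≈ u * y → x ≈ y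
  *-cancelˡ-invertible {u} {v} {x} {y} vu≈1 ux≈uy = begin
    x             ≈⟨ *-identityˡ x ⟨
    1# * x        ≈⟨ *-congʳ vu≈1 ⟨
    (v * u) * x   ≈⟨ *-assoc v u x ⟩
    v * (u * x)   ≈⟨ *-congˡ ux≈uy ⟩
    v * (u * y)   ≈⟨ *-assoc v u y ⟨
    (v * u) * y   ≈⟨ *-congʳ vu≈1 ⟩
    1# * y        ≈⟨ *-identityˡ y ⟩
    y             ∎

  -- Agrees definitionally with hessMatrix when α is alpha; here α is arbitrary.
  hessenbergEntry : (ℤ → Carrier) → (ℕ → Carrier) → ℕ → ℕ → ℕ → Carrier
  hessenbergEntry α r n i j = if does (suc i ℕ.≟ n) then r (n ∸ j) else α (+ suc i ℤ.- + j)

  hessenberg : (ℤ → Carrier) → (ℕ → Carrier) → ∀ n → Fin n → Fin n → Carrier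
  hessenberg α r n i j = hessenbergEntry α r n (toℕ i) (toℕ j)

  SolvesToeplitzSystem : (ℤ → Carrier) → (ℕ → Carrier) → (ℕ → Carrier) → Set ℓ
  SolvesToeplitzSystem α r x = ∀ n → sum1 K (suc n) (λ i → α (+ (suc n ∸ i)) * x i) ≈ - r (suc n)

  toeplitz-diagonal : ∀ (α : ℤ → Carrier) → α (+ 0) ≈ 1# → ∀ n z → α (+ (n ∸ n)) * z ≈ z
  toeplitz-diagonal α α₀≈1 n z = begin
    α (+ (n ∸ n)) * z ≡⟨ ≡.cong (λ k → α (+ k) * z) (ℕP.n∸n≡0 n) ⟩
    α (+ 0) * z       ≈⟨ *-congʳ α₀≈1 ⟩
    1# * z            ≈⟨ *-identityˡ z ⟩
    z                 ∎

  toeplitzSystem-unique : ∀ {α r x y} → α (+ 0) ≈ 1# →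
                          SolvesToeplitzSystem α r x → SolvesToeplitzSystem α r y →
                          ∀ n → x (suc n) ≈ y (suc n)
  toeplitzSystem-unique {α} {r} {x} {y} α₀≈1 x-solves y-solves =
    <-rec (λ n → x (suc n) ≈ y (suc n)) step
    where
    step : ∀ n → (∀ {m} → m < n → x (suc m) ≈ y (suc m)) → x (suc n) ≈ y (suc n)
    step n ih = begin
      x (suc n)                         ≈⟨ toeplitz-diagonal α α₀≈1 n (x (suc n)) ⟨
      α (+ (suc n ∸ suc n)) * x (suc n) ≈⟨ +-cancelˡ (earlier y) _ _ same-total ⟩
      α (+ (suc n ∸ suc n)) * y (suc n) ≈⟨ toeplitz-diagonal α α₀≈1 n (y (suc n)) ⟩
      y (suc n)                         ∎
      where
      earlier : (ℕ → Carrier) → Carrier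
      earlier z = sum1 K n (λ i → α (+ (suc n ∸ i)) * z i)

      same-total : earlier y + α (+ (suc n ∸ suc n)) * x (suc n)
                 ≈ earlier y + α (+ (suc n ∸ suc n)) * y (suc n)
      same-total = begin
        earlier y + α (+ (suc n ∸ suc n)) * x (suc n)
          ≈⟨ +-congʳ (sum1-cong n λ { (suc m) _ m<n → *-congˡ (ih m<n) }) ⟨
        sum1 K (suc n) (λ i → α (+ (suc n ∸ i)) * x i) ≈⟨ x-solves n ⟩
        - r (suc n)                                    ≈⟨ y-solves n ⟨
        sum1 K (suc n) (λ i → α (+ (suc n ∸ i)) * y i) ∎

  module HessenbergToeplitz (α : ℤ → Carrier) (α₀≈1 : α (+ 0) ≈ 1#)
                            (α₋≈0 : ∀ m → α -[1+ m ] ≈ 0#) (r : ℕ → Carrier) where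

    signedDet : ℕ → Carrier
    signedDet n = sign K n * det K n (hessenberg α r n)

    withFirstColumn : (ℕ → Carrier) → ∀ n → Fin n → Fin n → Carrier
    withFirstColumn g n i Fin.zero    = g (toℕ i)
    withFirstColumn g n i (Fin.suc j) = hessenberg α r n i (Fin.suc j)

    columnDet : (ℕ → Carrier) → ℕ → Carrier
    columnDet g n = sign K n * det K n (withFirstColumn g n)

    hessenbergEntry-shift : ∀ n i j →
      hessenbergEntry α r (suc n) (suc i) (suc j) ≡ hessenbergEntry α r n i j
    hessenbergEntry-shift n i j =
      ≡.cong (λ k → if does (suc i ℕ.≟ n) then r (n ∸ j) else α k)
             (+[1+m]-+[1+n]≡+m-+n (suc i) j)

    -- The first row is g 0, α₀ = 1, α₋₁, α₋₂, …, and both surviving minors are shifts.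
    det-withFirstColumn-suc : ∀ g n →
      det K (suc (suc n)) (withFirstColumn g (suc (suc n)))
        ≈ g 0 * det K (suc n) (hessenberg α r (suc n))
          + - det K (suc n) (withFirstColumn (λ k → g (suc k)) (suc n))
    det-withFirstColumn-suc g n = begin
      det K (suc (suc n)) M
        ≈⟨ +-cong (*-identityˡ _) (+-cong (-1*x≈-x _) (sumFin-zero n λ j →
             trans (*-congˡ (trans (*-congʳ (α₋≈0 (toℕ j))) (zeroˡ _))) (zeroʳ _))) ⟩
      g 0 * det K (suc n) (minor Fin.zero)
        + (- (α (+ 0) * det K (suc n) (minor (Fin.suc Fin.zero))) + 0#)
        ≈⟨ +-cong (*-congˡ (det-cong (suc n) minor₀))
                  (trans (+-identityʳ _) (-‿cong (*-cong α₀≈1 (det-cong (suc n) minor₁)))) ⟩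
      g 0 * det K (suc n) (hessenberg α r (suc n)) + - (1# * D)
        ≈⟨ +-congˡ (-‿cong (*-identityˡ D)) ⟩
      g 0 * det K (suc n) (hessenberg α r (suc n)) + - D ∎
      where
      M : Fin (suc (suc n)) → Fin (suc (suc n)) → Carrier
      M = withFirstColumn g (suc (suc n))
      minor : Fin (suc (suc n)) → Fin (suc n) → Fin (suc n) → Carrier
      minor j i s = M (Fin.suc i) (punchIn j s)
      D : Carrier
      D = det K (suc n) (withFirstColumn (λ k → g (suc k)) (suc n))
      minor₀ : ∀ i j → minor Fin.zero i j ≈ hessenberg α r (suc n) i j
      minor₀ i j = reflexive (hessenbergEntry-shift (suc n) (toℕ i) (toℕ j))
      minor₁ : ∀ i j → minor (Fin.suc Fin.zero) i j ≈ withFirstColumn (λ k → g (suc k)) (suc n) i j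
      minor₁ i Fin.zero    = refl
      minor₁ i (Fin.suc j) = reflexive (hessenbergEntry-shift (suc n) (toℕ i) (suc (toℕ j)))

    columnDet-suc : ∀ g n → columnDet g (suc (suc n))
                          ≈ columnDet (λ k → g (suc k)) (suc n) + - (g 0 * signedDet (suc n))
    columnDet-suc g n = trans (*-congˡ (det-withFirstColumn-suc g n)) (rearrange (sign K n) (g 0) _ _)
      where
      rearrange : ∀ s a h d → (- - s) * (a * h + - d) ≈ (- s) * d + - (a * ((- s) * h))
      rearrange s a h d = begin
        (- - s) * (a * h + - d)     ≈⟨ *-congʳ (-‿involutive s) ⟩
        s * (a * h + - d)           ≈⟨ distribˡ s _ _ ⟩
        s * (a * h) + s * - d       ≈⟨ +-comm _ _ ⟩
        s * - d + s * (a * h)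
          ≈⟨ +-cong (trans (sym (-‿distribʳ-* s d)) (-‿distribˡ-* s d)) (begin
            s * (a * h)             ≈⟨ x∙yz≈y∙xz s a h ⟩
            a * (s * h)             ≈⟨ -‿involutive _ ⟨
            - - (a * (s * h))
              ≈⟨ -‿cong (trans (-‿distribʳ-* a _) (*-congˡ (-‿distribˡ-* s h))) ⟩
            - (a * ((- s) * h))     ∎) ⟩
        (- s) * d + - (a * ((- s) * h)) ∎

    columnDet-expansion : ∀ g n → columnDet g (suc n) ≈ - sum0 K n (λ i → g (n ∸ i) * signedDet i)
    columnDet-expansion g zero = begin
      - 1# * (1# * (g 0 * 1#) + 0#) ≈⟨ -1*x≈-x _ ⟩
      - (1# * (g 0 * 1#) + 0#)      ≈⟨ -‿cong (trans (+-identityʳ _) (trans (*-identityˡ _)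
                                                 (*-congˡ (sym (*-identityˡ 1#))))) ⟩
      - (g 0 * (1# * 1#))           ∎
    columnDet-expansion g (suc n) = begin
      columnDet g (suc (suc n))
        ≈⟨ columnDet-suc g n ⟩
      columnDet (λ k → g (suc k)) (suc n) + - (g 0 * signedDet (suc n))
        ≈⟨ +-cong (columnDet-expansion (λ k → g (suc k)) n)
                  (-‿cong (*-congʳ (reflexive (≡.cong g (≡.sym (ℕP.n∸n≡0 n)))))) ⟩
      - sum0 K n (λ i → g (suc (n ∸ i)) * signedDet i) + - (g (n ∸ n) * signedDet (suc n))
        ≈⟨ +-congʳ (-‿cong (sum0-cong n λ i i≤n →
             *-congʳ (reflexive (≡.cong g (≡.sym (ℕP.+-∸-assoc 1 i≤n)))))) ⟩
      - sum0 K n (λ i → g (suc n ∸ i) * signedDet i) + - (g (n ∸ n) * signedDet (suc n))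
        ≈⟨ -‿+-comm _ _ ⟩
      - sum0 K (suc n) (λ i → g (suc n ∸ i) * signedDet i) ∎

    signedDet-expansion : ∀ n → signedDet (suc n)
                              ≈ - (r (suc n) + sum1 K n (λ i → α (+ (suc n ∸ i)) * signedDet i))
    signedDet-expansion n = begin
      signedDet (suc n)
        ≈⟨ *-congˡ (det-cong (suc n) {hessenberg α r (suc n)} {withFirstColumn firstColumn (suc n)}
                             λ { i Fin.zero → refl ; i (Fin.suc j) → refl }) ⟩
      columnDet firstColumn (suc n)
        ≈⟨ columnDet-expansion firstColumn n ⟩
      - sum0 K n (λ i → firstColumn (n ∸ i) * signedDet i)
        ≈⟨ -‿cong (sum0≈head+sum1 n _) ⟩
      - (firstColumn n * signedDet 0 + sum1 K n (λ i → firstColumn (n ∸ i) * signedDet i))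
        ≈⟨ -‿cong (+-cong lastRow (sum1-cong n λ i 1≤i i≤n →
                                     *-congʳ (reflexive (subdiagonal i 1≤i i≤n)))) ⟩
      - (r (suc n) + sum1 K n (λ i → α (+ (suc n ∸ i)) * signedDet i)) ∎
      where
      firstColumn : ℕ → Carrier
      firstColumn k = hessenbergEntry α r (suc n) k 0

      lastRow : firstColumn n * signedDet 0 ≈ r (suc n)
      lastRow = begin
        firstColumn n * (1# * 1#) ≈⟨ *-congˡ (*-identityˡ 1#) ⟩
        firstColumn n * 1#        ≈⟨ *-identityʳ _ ⟩
        firstColumn n             ≡⟨ if-cong (dec-true (suc n ℕ.≟ suc n) ≡.refl) ⟩
        r (suc n)                 ∎

      subdiagonal : ∀ i → 1 ≤ i → i ≤ n → firstColumn (n ∸ i) ≡ α (+ (suc n ∸ i))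
      subdiagonal i 1≤i i≤n = ≡.trans
        (if-cong (dec-false (suc (n ∸ i) ℕ.≟ suc n)
                            λ eq → ℕP.<-irrefl (ℕP.suc-injective eq) n∸i<n))
        (≡.cong α (≡.trans (ℤP.+-identityʳ (+ suc (n ∸ i)))
                           (≡.cong +_ (≡.sym (ℕP.+-∸-assoc 1 i≤n)))))
        where
        n∸i<n : n ∸ i < n
        n∸i<n = ℕP.∸-monoʳ-< {n} {i} {0} 1≤i i≤n

    signedDet-solvesToeplitzSystem : SolvesToeplitzSystem α r signedDet
    signedDet-solvesToeplitzSystem n = begin
      sum1 K n (λ i → α (+ (suc n ∸ i)) * signedDet i) + α (+ (n ∸ n)) * signedDet (suc n)
        ≈⟨ +-congˡ (toeplitz-diagonal α α₀≈1 n (signedDet (suc n))) ⟩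
      S + signedDet (suc n) ≈⟨ +-congˡ (signedDet-expansion n) ⟩
      S + - (r (suc n) + S) ≈⟨ +-congˡ (-‿cong (+-comm _ _)) ⟩
      S + - (S + r (suc n)) ≈⟨ +-congˡ (-‿+-comm S _) ⟨
      S + (- S + - r (suc n)) ≈⟨ +-assoc _ _ _ ⟨
      S + - S + - r (suc n) ≈⟨ +-congʳ (-‿inverseʳ S) ⟩
      0# + - r (suc n)      ≈⟨ +-identityˡ _ ⟩
      - r (suc n)           ∎
      where
      S : Carrier
      S = sum1 K n (λ i → α (+ (suc n ∸ i)) * signedDet i)

frac-* : ∀ a b c d e f → a ℕ.* c ℕ.* suc f ≡ e ℕ.* (suc b ℕ.* suc d) →
         frac (+ a) (suc b) ℚ.* frac (+ c) (suc d) ≡ frac (+ e) (suc f)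
frac-* a b c d e f cross = ℚP.toℚᵘ-injective product-≃
  where
  cross-ℤ : (+ a ℤ.* + c) ℤ.* + suc f ≡ + e ℤ.* + (suc b ℕ.* suc d)
  cross-ℤ = begin
    (+ a ℤ.* + c) ℤ.* + suc f    ≡⟨ ≡.cong (ℤ._* + suc f) (ℤP.pos-* a c) ⟨
    + (a ℕ.* c) ℤ.* + suc f      ≡⟨ ℤP.pos-* (a ℕ.* c) (suc f) ⟨
    + (a ℕ.* c ℕ.* suc f)        ≡⟨ ≡.cong +_ cross ⟩
    + (e ℕ.* (suc b ℕ.* suc d))  ≡⟨ ℤP.pos-* e (suc b ℕ.* suc d) ⟩
    + e ℤ.* + (suc b ℕ.* suc d)  ∎
    where open ≡.≡-Reasoning

  product-≃ : ℚ.toℚᵘ (frac (+ a) (suc b) ℚ.* frac (+ c) (suc d))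
              ℚᵘ.≃ ℚ.toℚᵘ (frac (+ e) (suc f))
  product-≃ = begin
    ℚ.toℚᵘ (frac (+ a) (suc b) ℚ.* frac (+ c) (suc d))
      ≈⟨ ℚP.toℚᵘ-homo-* (frac (+ a) (suc b)) (frac (+ c) (suc d)) ⟩
    ℚ.toℚᵘ (frac (+ a) (suc b)) ℚᵘ.* ℚ.toℚᵘ (frac (+ c) (suc d))
      ≈⟨ ℚᵘP.*-cong (ℚP.toℚᵘ-fromℚᵘ (mkℚᵘ (+ a) b))
                    (ℚP.toℚᵘ-fromℚᵘ (mkℚᵘ (+ c) d)) ⟩
    mkℚᵘ (+ a) b ℚᵘ.* mkℚᵘ (+ c) d
      ≈⟨ *≡* cross-ℤ ⟩
    mkℚᵘ (+ e) f
      ≈⟨ ℚP.toℚᵘ-fromℚᵘ (mkℚᵘ (+ e) f) ⟨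
    ℚ.toℚᵘ (frac (+ e) (suc f)) ∎
    where open ℚᵘP.≃-Reasoning

module _ {c ℓ : Level} (K : CommutativeRing c ℓ) (ι : ℚ → CommutativeRing.Carrier K)
         (ι-hom : IsQAlgebra K ι) where
  open CommutativeRing K
  open IsRingHomomorphism ι-hom using (*-homo; 1#-homo; +-homo; 0#-homo; -‿homo)
  open import Algebra.Properties.CommutativeSemigroup *-commutativeSemigroup using (x∙yz≈y∙xz)
  open import Relation.Binary.Reasoning.Setoid setoid

  private
    -- Normalisation needs decidable equality of coefficients, which K lacks; take them in ℚ.
    module ℚ-Solver where
      open import Algebra.Solver.Ring.AlmostCommutativeRing
        using (fromCommutativeRing; _-Raw-AlmostCommutative⟶_)
      ι-morphism : +-*-rawRing -Raw-AlmostCommutative⟶ fromCommutativeRing K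
      ι-morphism = record { ⟦_⟧ = ι ; +-homo = +-homo ; *-homo = *-homo ; -‿homo = -‿homo
                          ; 0-homo = 0#-homo ; 1-homo = 1#-homo }
      ι-≟ : ∀ p q → Maybe (ι p ≈ ι q)
      ι-≟ p q with p ℚP.≟ q
      ... | yes ≡.refl = just refl
      ... | no _       = nothing
      open import Algebra.Solver.Ring +-*-rawRing (fromCommutativeRing K) ι-morphism ι-≟ public
  open ℚ-Solver using (solve; _:+_; _:*_; :-_; _:=_)

  fromℕ : ℕ → Carrier
  fromℕ a = ι (frac (+ a) 1)

  1/_ : ℕ → Carrier
  1/ q = ι (frac (+ 1) q)

  ι-frac-* : ∀ a b c d e f → a ℕ.* c ℕ.* suc f ≡ e ℕ.* (suc b ℕ.* suc d) →
             ι (frac (+ a) (suc b)) * ι (frac (+ c) (suc d)) ≈ ι (frac (+ e) (suc f))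
  ι-frac-* a b c d e f cross = trans (sym (*-homo _ _)) (reflexive (≡.cong ι (frac-* a b c d e f cross)))

  ι-frac : ∀ p q → 1 ≤ q → ι (frac (+ p) q) ≈ fromℕ p * 1/ q
  ι-frac p (suc q) _ = sym (ι-frac-* p 0 1 q p q (ℕP.*-assoc p 1 (suc q)))

  1/-inverseˡ : ∀ q → 1 ≤ q → 1/ q * fromℕ q ≈ 1#
  1/-inverseˡ (suc q) _ = trans (ι-frac-* 1 q (suc q) 0 1 0 (ℕP.*-assoc 1 (suc q) 1)) 1#-homo

  fromℕ-* : ∀ a b → fromℕ (a ℕ.* b) ≈ fromℕ a * fromℕ b
  fromℕ-* a b = sym (ι-frac-* a 0 b 0 (a ℕ.* b) 0 ≡.refl)

  1/-* : ∀ a b → 1 ≤ a → 1 ≤ b → 1/ (a ℕ.* b) ≈ 1/ a * 1/ b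
  1/-* (suc a) (suc b) _ _ = sym (ι-frac-* 1 a 1 b 1 (b ℕ.+ a ℕ.* suc b) ≡.refl)

  -- The exponentials e^{at} of the generating functions become e^{u(a) t}: u a = a gives
  -- B_{N,n,χ}, u a = x + a gives B_{N,n,χ}(x).
  module GeneratingFunction (N f : ℕ) (χ : ℕ → Carrier) (u : ℕ → Carrier) where

    α : ℤ → Carrier
    α = alpha K ι N f χ

    numeratorCoeff : ℕ → Carrier
    numeratorCoeff k = if does (N ℕ.≤? k)
      then sum1 K f (λ a → χ a * (pow K (u a) (k ∸ N) * 1/ (((k ∸ N) !) ℕ.* (N !))))
      else 0#

    Ŝ : ℕ → Carrier
    Ŝ m = 1/ (f ℕ.^ N) * sum1 K f (λ a →
      χ a * (ι (frac (+ (N ! ℕ.* (f ℕ.^ m))) ((N ℕ.+ m) !)) - pow K (u a) m * 1/ (m !)))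

    moment : ℕ → Carrier
    moment m = sum1 K f (λ a → χ a * pow K (u a) m)

    leadingCoeff : Carrier
    leadingCoeff = fromℕ (f ℕ.^ N) * 1/ (N !)

    denomCoeff-+ : ∀ j → denomCoeff K ι N f χ (N ℕ.+ j) ≈ leadingCoeff * α (+ j)
    denomCoeff-+ j = trans (reflexive (if-cong (dec-true (N ℕ.≤? N ℕ.+ j) (ℕP.m≤m+n N j))))
                           (coeff j)
      where
      coeff : ∀ j → ι (frac (+ (f ℕ.^ (N ℕ.+ j))) ((N ℕ.+ j) !)) ≈ leadingCoeff * α (+ j)
      coeff zero = begin
        ι (frac (+ (f ℕ.^ (N ℕ.+ 0))) ((N ℕ.+ 0) !))
          ≡⟨ ≡.cong (λ n → ι (frac (+ (f ℕ.^ n)) (n !))) (ℕP.+-identityʳ N) ⟩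
        ι (frac (+ (f ℕ.^ N)) (N !))  ≈⟨ ι-frac (f ℕ.^ N) (N !) (ℕP.1≤n! N) ⟩
        leadingCoeff                  ≈⟨ *-identityʳ _ ⟨
        leadingCoeff * 1#             ∎
      coeff (suc j) = begin
        ι (frac (+ (f ℕ.^ (N ℕ.+ suc j))) Q)
          ≈⟨ ι-frac _ Q (ℕP.1≤n! (N ℕ.+ suc j)) ⟩
        fromℕ (f ℕ.^ (N ℕ.+ suc j)) * 1/ Q
          ≈⟨ *-congʳ (trans (reflexive (≡.cong fromℕ (ℕP.^-distribˡ-+-* f N (suc j))))
                            (fromℕ-* (f ℕ.^ N) (f ℕ.^ suc j))) ⟩
        (fromℕ (f ℕ.^ N) * fromℕ (f ℕ.^ suc j)) * 1/ Q
          ≈⟨ *-identityˡ _ ⟨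
        1# * ((fromℕ (f ℕ.^ N) * fromℕ (f ℕ.^ suc j)) * 1/ Q)
          ≈⟨ *-congʳ (1/-inverseˡ (N !) (ℕP.1≤n! N)) ⟨
        (1/ (N !) * fromℕ (N !)) * ((fromℕ (f ℕ.^ N) * fromℕ (f ℕ.^ suc j)) * 1/ Q)
          ≈⟨ solve 5 (λ i n x y q → (i :* n) :* ((x :* y) :* q) := (x :* i) :* ((n :* y) :* q))
                     refl _ _ _ _ _ ⟩
        leadingCoeff * ((fromℕ (N !) * fromℕ (f ℕ.^ suc j)) * 1/ Q)
          ≈⟨ *-congˡ (trans (ι-frac _ Q (ℕP.1≤n! (N ℕ.+ suc j)))
                            (*-congʳ (fromℕ-* (N !) (f ℕ.^ suc j)))) ⟨
        leadingCoeff * α (+ suc j) ∎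
        where
        Q : ℕ
        Q = (N ℕ.+ suc j) !

    denomCoeff-< : ∀ {k} → k < N → denomCoeff K ι N f χ k ≡ 0#
    denomCoeff-< {k} k<N = if-cong (dec-false (N ℕ.≤? k) (ℕP.<⇒≱ k<N))

    numeratorCoeff-+ : ∀ m → numeratorCoeff (N ℕ.+ m) ≈ moment m * 1/ (m ! ℕ.* N !)
    numeratorCoeff-+ m = begin
      numeratorCoeff (N ℕ.+ m)
        ≡⟨ if-cong (dec-true (N ℕ.≤? N ℕ.+ m) (ℕP.m≤m+n N m)) ⟩
      sum1 K f (λ a → χ a * (pow K (u a) ((N ℕ.+ m) ∸ N) * 1/ ((((N ℕ.+ m) ∸ N) !) ℕ.* (N !))))
        ≡⟨ ≡.cong (λ k → sum1 K f (λ a → χ a * (pow K (u a) k * 1/ ((k !) ℕ.* (N !)))))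
                  (ℕP.m+n∸m≡n N m) ⟩
      sum1 K f (λ a → χ a * (pow K (u a) m * 1/ (m ! ℕ.* N !)))
        ≈⟨ sum1-cong K f (λ a _ _ → sym (*-assoc _ _ _)) ⟩
      sum1 K f (λ a → (χ a * pow K (u a) m) * 1/ (m ! ℕ.* N !))
        ≈⟨ sum1-*ʳ K f _ _ ⟩
      moment m * 1/ (m ! ℕ.* N !) ∎

    Ŝ-suc : ∀ n →
      Ŝ (suc n) ≈ 1/ (f ℕ.^ N) * (sum1 K f χ * α (+ suc n) + - (moment (suc n) * 1/ (suc n !)))
    Ŝ-suc n = *-congˡ (begin
      sum1 K f (λ a → χ a * (α (+ suc n) + - (pow K (u a) (suc n) * κ)))
        ≈⟨ sum1-cong K f (λ a _ _ →
             solve 4 (λ x A p k → x :* (A :+ :- (p :* k)) := x :* A :+ :- ((x :* p) :* k))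
                     refl (χ a) _ _ _) ⟩
      sum1 K f (λ a → χ a * α (+ suc n) + - ((χ a * pow K (u a) (suc n)) * κ))
        ≈⟨ trans (sum1-+ K f _ _)
                 (+-cong (sum1-*ʳ K f _ _) (trans (sum1-neg K f _) (-‿cong (sum1-*ʳ K f _ _)))) ⟩
      sum1 K f χ * α (+ suc n) + - (moment (suc n) * κ) ∎)
      where
      κ : Carrier
      κ = 1/ (suc n !)

    module _ (f≥1 : 1 ≤ f) {B : ℕ → Carrier} (B-gen : IsGenSeq K ι N f χ numeratorCoeff B) where

      b : ℕ → Carrier
      b i = B i * 1/ (i !)

      toeplitzSum : ℕ → Carrier
      toeplitzSum m = sum0 K m (λ i → α (+ (m ∸ i)) * b i)

      fᴺ≥1 : 1 ≤ f ℕ.^ N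
      fᴺ≥1 = ℕP.m^n>0 f {{ℕ.>-nonZero f≥1}} N

      -- The denominator series starts at t^N, so the coefficient of t^{N+m} only sees b_0, …, b_m.
      convolution-+ : ∀ m → sum0 K (N ℕ.+ m) (λ i → b i * denomCoeff K ι N f χ ((N ℕ.+ m) ∸ i))
                            ≈ leadingCoeff * toeplitzSum m
      convolution-+ m = begin
        sum0 K (N ℕ.+ m) (λ i → b i * denomCoeff K ι N f χ ((N ℕ.+ m) ∸ i))
          ≈⟨ sum0-vanishing-tail K m N _ beyond-m ⟩
        sum0 K m (λ i → b i * denomCoeff K ι N f χ ((N ℕ.+ m) ∸ i))
          ≈⟨ sum0-cong K m up-to-m ⟩
        sum0 K m (λ i → leadingCoeff * (α (+ (m ∸ i)) * b i))
          ≈⟨ sum0-*ˡ K m leadingCoeff _ ⟩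
        leadingCoeff * toeplitzSum m ∎
        where
        beyond-m : ∀ i → m < i → i ≤ N ℕ.+ m →
                   b i * denomCoeff K ι N f χ ((N ℕ.+ m) ∸ i) ≈ 0#
        beyond-m i m<i i≤N+m = trans (*-congˡ (reflexive (denomCoeff-< N+m∸i<N))) (zeroʳ _)
          where
          N+m∸i<N : (N ℕ.+ m) ∸ i < N
          N+m∸i<N = ≡.subst ((N ℕ.+ m) ∸ i <_) (ℕP.m+n∸n≡m N m)
                            (ℕP.∸-monoʳ-< {N ℕ.+ m} {i} {m} m<i i≤N+m)
        up-to-m : ∀ i → i ≤ m →
                  b i * denomCoeff K ι N f χ ((N ℕ.+ m) ∸ i) ≈ leadingCoeff * (α (+ (m ∸ i)) * b i)
        up-to-m i i≤m = begin
          b i * denomCoeff K ι N f χ ((N ℕ.+ m) ∸ i)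
            ≡⟨ ≡.cong (λ k → b i * denomCoeff K ι N f χ k) (ℕP.+-∸-assoc N i≤m) ⟩
          b i * denomCoeff K ι N f χ (N ℕ.+ (m ∸ i))
            ≈⟨ *-congˡ (denomCoeff-+ (m ∸ i)) ⟩
          b i * (leadingCoeff * α (+ (m ∸ i)))
            ≈⟨ solve 3 (λ x l a → x :* (l :* a) := l :* (a :* x)) refl _ _ _ ⟩
          leadingCoeff * (α (+ (m ∸ i)) * b i) ∎

      toeplitzSum-value : ∀ m → toeplitzSum m ≈ 1/ (f ℕ.^ N) * (moment m * 1/ (m !))
      toeplitzSum-value m = *-cancelˡ-invertible K leadingCoeff-invertible (begin
        leadingCoeff * toeplitzSum m   ≈⟨ convolution-+ m ⟨
        _                              ≈⟨ B-gen (N ℕ.+ m) ⟩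
        numeratorCoeff (N ℕ.+ m)       ≈⟨ numeratorCoeff-+ m ⟩
        moment m * 1/ (m ! ℕ.* N !)
          ≈⟨ *-congˡ (1/-* (m !) (N !) (ℕP.1≤n! m) (ℕP.1≤n! N)) ⟩
        moment m * (1/ (m !) * 1/ (N !))
          ≈⟨ *-identityˡ _ ⟨
        1# * (moment m * (1/ (m !) * 1/ (N !)))
          ≈⟨ *-congʳ (1/-inverseˡ (f ℕ.^ N) fᴺ≥1) ⟨
        (1/ (f ℕ.^ N) * fromℕ (f ℕ.^ N)) * (moment m * (1/ (m !) * 1/ (N !)))
          ≈⟨ solve 5 (λ i F P k j → (i :* F) :* (P :* (k :* j)) := (F :* j) :* (i :* (P :* k)))
                     refl _ _ _ _ _ ⟩
        leadingCoeff * (1/ (f ℕ.^ N) * (moment m * 1/ (m !))) ∎)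
        where
        leadingCoeff-invertible : (fromℕ (N !) * 1/ (f ℕ.^ N)) * leadingCoeff ≈ 1#
        leadingCoeff-invertible = begin
          (fromℕ (N !) * 1/ (f ℕ.^ N)) * (fromℕ (f ℕ.^ N) * 1/ (N !))
            ≈⟨ solve 4 (λ n i F j → (n :* i) :* (F :* j) := (j :* n) :* (i :* F)) refl _ _ _ _ ⟩
          (1/ (N !) * fromℕ (N !)) * (1/ (f ℕ.^ N) * fromℕ (f ℕ.^ N))
            ≈⟨ *-cong (1/-inverseˡ (N !) (ℕP.1≤n! N)) (1/-inverseˡ (f ℕ.^ N) fᴺ≥1) ⟩
          1# * 1#
            ≈⟨ *-identityˡ 1# ⟩
          1# ∎

      b₀-value : b 0 ≈ 1/ (f ℕ.^ N) * sum1 K f χ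
      b₀-value = begin
        b 0                              ≈⟨ *-identityˡ (b 0) ⟨
        toeplitzSum 0                    ≈⟨ toeplitzSum-value 0 ⟩
        1/ (f ℕ.^ N) * (moment 0 * 1/ 1) ≈⟨ *-congˡ (trans (*-congˡ 1#-homo) (*-identityʳ _)) ⟩
        1/ (f ℕ.^ N) * moment 0          ≈⟨ *-congˡ (sum1-cong K f λ a _ _ → *-identityʳ (χ a)) ⟩
        1/ (f ℕ.^ N) * sum1 K f χ        ∎

      b-solvesToeplitzSystem : SolvesToeplitzSystem K α Ŝ b
      b-solvesToeplitzSystem n = begin
        T
          ≈⟨ solve 2 (λ h T → T := (h :+ T) :+ :- h) refl (α (+ suc n) * b 0) T ⟩
        (α (+ suc n) * b 0 + T) + - (α (+ suc n) * b 0)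
          ≈⟨ +-cong (trans (sym (sum0≈head+sum1 K (suc n) _)) (toeplitzSum-value (suc n)))
                    (-‿cong (*-congˡ b₀-value)) ⟩
        1/ (f ℕ.^ N) * (moment (suc n) * κ) + - (α (+ suc n) * (1/ (f ℕ.^ N) * sum1 K f χ))
          ≈⟨ solve 5 (λ F P k a S → F :* (P :* k) :+ :- (a :* (F :* S))
                                 := :- (F :* (S :* a :+ :- (P :* k)))) refl _ _ _ _ _ ⟩
        - (1/ (f ℕ.^ N) * (sum1 K f χ * α (+ suc n) + - (moment (suc n) * κ)))
          ≈⟨ -‿cong (Ŝ-suc n) ⟨
        - Ŝ (suc n) ∎
        where
        T κ : Carrier
        T = sum1 K (suc n) (λ i → α (+ (suc n ∸ i)) * b i)
        κ = 1/ (suc n !)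

      open HessenbergToeplitz K α refl (λ _ → refl) Ŝ using (signedDet; signedDet-solvesToeplitzSystem)

      hessenberg-formula : ∀ n →
        B (suc n) ≈ sign K (suc n) * (fromℕ (suc n !) * det K (suc n) (hessenberg K α Ŝ (suc n)))
      hessenberg-formula n = begin
        B (suc n)                              ≈⟨ *-identityʳ _ ⟨
        B (suc n) * 1#
          ≈⟨ *-congˡ (1/-inverseˡ (suc n !) (ℕP.1≤n! (suc n))) ⟨
        B (suc n) * (1/ (suc n !) * fromℕ (suc n !))
          ≈⟨ solve 3 (λ B i q → B :* (i :* q) := q :* (B :* i)) refl _ _ _ ⟩
        fromℕ (suc n !) * b (suc n)
          ≈⟨ *-congˡ (toeplitzSystem-unique K {α} {Ŝ} refl b-solvesToeplitzSystem
                                                           signedDet-solvesToeplitzSystem n) ⟩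
        fromℕ (suc n !) * signedDet (suc n)    ≈⟨ x∙yz≈y∙xz _ _ _ ⟩
        sign K (suc n) * (fromℕ (suc n !) * det K (suc n) (hessenberg K α Ŝ (suc n))) ∎

theorem6p1 : ∀ {c ℓ : Level} (K : CommutativeRing c ℓ) →
    let open CommutativeRing K in
    (ι : ℚ → Carrier) → IsQAlgebra K ι →
    (N : ℕ) → 1 ≤ N →
    (f : ℕ) (χ : ℕ → Carrier) → HasConductor K f χ →
    (B : ℕ → Carrier) → IsHypBernoulli K ι N f χ B →
    (Bx : Carrier → ℕ → Carrier) → (∀ x → IsHypBernoulliPoly K ι N f χ x (Bx x)) →
    ∀ n → 1 ≤ n →
      (B n ≈ sign K n * (nat K ι N f χ (n !) * det K n (Mmat K ι N f χ n)))
      × (∀ x → Bx x n ≈ sign K n * (nat K ι N f χ (n !) * det K n (Mmatx K ι N f χ x n)))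
theorem6p1 K ι ι-hom N _ f χ conductor B B-gen Bx Bx-gen (suc n) _ =
  hessenberg-formula (nat K ι N f χ) f≥1 B-gen n ,
  λ x → hessenberg-formula (λ a → x + nat K ι N f χ a) f≥1 (Bx-gen x) n
  where
  open CommutativeRing K using (_+_)
  open GeneratingFunction K ι ι-hom N f χ using (hessenberg-formula)
  f≥1 : 1 ≤ f
  f≥1 = HasConductor.f≥1 conductor
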